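{- Let $(V,H)$ be a $3$-uniform hypergraph with finite vertex set $V$, and suppose that no line of $(V,H)$ is universal (i.e., no line equals $V$). Let $\mathcal{L}$ be the set of all lines, and define $\alpha,\beta:V\to 2^{\mathcal{L}}$ by $\alpha(x)=\{L\in\mathcal{L}: x\in L\}$ and $\beta(x)=\{\overline{xw}: w\in V,\ w\neq x\}$. If $f:V\to 2^{\mathcal{L}}$ is any mapping such that $\beta(x)\subseteq f(x)\subseteq \alpha(x)$ for all $x\in V$, then $f$ is one-to-one and $\{f(x):x\in V\}$ is an antichain (no member is a subset of another distinct member).
   Context: A $3$-uniform hypergraph is a pair $(V,H)$ where $H$ is a family of $3$-element subsets of $V$ (called hedges). For distinct vertices $u,v$, the line $\overline{uv}$ is defined as $\overline{uv}=\{u,v\}\cup\{p\in V:\{u,v,p\}\in H\}$. A line is universal if it equals $V$. Note $\beta(x)\subseteq\alpha(x)$ always. -}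

module Defs where

open import Data.Nat using (ℕ)
open import Data.Bool using (Bool; true; false; _∨_)
open import Data.Fin using (Fin; _≟_)
open import Data.Fin.Subset using (Subset; ⁅_⁆; _∪_; ∣_∣; _∈_)
open import Data.Vec using (tabulate)
open import Data.Product using (Σ; ∃; _×_; _,_)
open import Relation.Nullary using (¬_; ⌊_⌋)
open import Relation.Binary.PropositionalEquality using (_≡_; _≢_)

record Hypergraph3 (n : ℕ) : Set where
  field
    H       : Subset n → Bool
    uniform : ∀ s → H s ≡ true → ∣ s ∣ ≡ 3

open Hypergraph3 public

line : ∀ {n} → Hypergraph3 n → Fin n → Fin n → Subset n
line G u v = tabulate λ p → ⌊ p ≟ u ⌋ ∨ ⌊ p ≟ v ⌋ ∨ H G (⁅ u ⁆ ∪ ⁅ v ⁆ ∪ ⁅ p ⁆)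

IsLine : ∀ {n} → Hypergraph3 n → Subset n → Set
IsLine G L = Σ _ λ u → Σ _ λ v → u ≢ v × L ≡ line G u v

-- sets of lines (subsets of 2^𝓛) are represented as predicates on Subset n
LineSet : ℕ → Set₁
LineSet n = Subset n → Set

α : ∀ {n} → Hypergraph3 n → Fin n → LineSet n
α G x L = IsLine G L × x ∈ L

β : ∀ {n} → Hypergraph3 n → Fin n → LineSet n
β G x L = Σ _ λ w → w ≢ x × L ≡ line G x w

_⊆ˡ_ : ∀ {n} → LineSet n → LineSet n → Set
A ⊆ˡ B = ∀ L → A L → B L

_≐ˡ_ : ∀ {n} → LineSet n → LineSet n → Set
A ≐ˡ B = A ⊆ˡ B × B ⊆ˡ A

module Submission where

open import Defs
open import Data.Nat using (ℕ)
open import Data.Bool using (T; _∨_)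
open import Data.Bool.Properties using (T-≡; T-∨)
open import Data.Fin using (Fin; _≟_)
open import Data.Fin.Properties using (¬∀⟶∃¬)
open import Data.Fin.Subset using (Subset; ⊤; ⁅_⁆; _∪_; _∈_; _∉_)
open import Data.Fin.Subset.Properties using (⊆-antisym; ⊆⊤; _∈?_; ∪-comm)
open import Data.Product using (∃; _×_; _,_; proj₁; proj₂)
open import Data.Sum using (_⊎_; inj₁; inj₂)
import Data.Sum as Sum
open import Data.Vec.Properties using ([]=⇒lookup; lookup⇒[]=; lookup∘tabulate)
open import Function using (id; _∘_)
open import Function.Bundles using (Equivalence; _⇔_; mk⇔)
open import Relation.Nullary using (yes; no; ⌊_⌋; contradiction)
open import Relation.Nullary.Decidable using (toWitness; fromWitness)
open import Relation.Binary.PropositionalEquality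
  using (_≡_; _≢_; refl; sym; trans; subst)

-- If f x ⊆ f y with x ≠ y, pick z off the non-universal line xy. Then
-- line x z ∈ β(x) ⊆ f(x) ⊆ f(y) ⊆ α(y), so y lies on line x z; as y ∉ {x, z}
-- this means {x, z, y} is a hedge, which puts z on line x y — a contradiction.
-- Hence f(x) ⊆ f(y) forces x = y, which gives both injectivity and the
-- antichain property.

p≢⊤⇒∃∉ : ∀ {n} {p : Subset n} → p ≢ ⊤ → ∃ λ x → x ∉ p
p≢⊤⇒∃∉ {n} {p} p≢⊤ =
  ¬∀⟶∃¬ n (_∈ p) (_∈? p) (λ ∀∈p → p≢⊤ (⊆-antisym ⊆⊤ (λ {x} _ → ∀∈p x)))

module _ {n : ℕ} (G : Hypergraph3 n) where

  ∈-line⇔T : ∀ {u v p} →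
             p ∈ line G u v ⇔ T (⌊ p ≟ u ⌋ ∨ ⌊ p ≟ v ⌋ ∨ H G (⁅ u ⁆ ∪ ⁅ v ⁆ ∪ ⁅ p ⁆))
  ∈-line⇔T {p = p} = mk⇔
    (λ p∈uv → from T-≡ (trans (sym (lookup∘tabulate _ p)) ([]=⇒lookup p∈uv)))
    (λ t → lookup⇒[]= p _ (trans (lookup∘tabulate _ p) (to T-≡ t)))
    where open Equivalence

  ∈-line⁻ : ∀ {u v p} → p ∈ line G u v →
            p ≡ u ⊎ p ≡ v ⊎ T (H G (⁅ u ⁆ ∪ ⁅ v ⁆ ∪ ⁅ p ⁆))
  ∈-line⁻ {u} {v} {p} p∈uv =
    Sum.map toWitness (Sum.map toWitness id ∘ to (T-∨ {⌊ p ≟ v ⌋}))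
      (to (T-∨ {⌊ p ≟ u ⌋}) (to ∈-line⇔T p∈uv))
    where open Equivalence

  ∈-line⁺ : ∀ {u v p} → p ≡ u ⊎ p ≡ v ⊎ T (H G (⁅ u ⁆ ∪ ⁅ v ⁆ ∪ ⁅ p ⁆)) →
            p ∈ line G u v
  ∈-line⁺ {u} {v} {p} cases =
    from ∈-line⇔T (from (T-∨ {⌊ p ≟ u ⌋})
      (Sum.map fromWitness (from (T-∨ {⌊ p ≟ v ⌋}) ∘ Sum.map fromWitness id) cases))
    where open Equivalence

  ∈-lineˡ : ∀ u v → u ∈ line G u v
  ∈-lineˡ u v = ∈-line⁺ (inj₁ refl)

  ∈-lineʳ : ∀ u v → v ∈ line G u v
  ∈-lineʳ u v = ∈-line⁺ (inj₂ (inj₁ refl))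

  ∈-line-exchange : ∀ {u v p} → p ∈ line G u v → p ≢ u → p ≢ v → v ∈ line G u p
  ∈-line-exchange {u} {v} {p} p∈uv p≢u p≢v with ∈-line⁻ p∈uv
  ... | inj₁ p≡u          = contradiction p≡u p≢u
  ... | inj₂ (inj₁ p≡v)   = contradiction p≡v p≢v
  ... | inj₂ (inj₂ hedge) =
    ∈-line⁺ (inj₂ (inj₂ (subst (λ s → T (H G (⁅ u ⁆ ∪ s))) (∪-comm ⁅ v ⁆ ⁅ p ⁆) hedge)))

  ∉-line⇒≢ˡ : ∀ {u v p} → p ∉ line G u v → p ≢ u
  ∉-line⇒≢ˡ {u} {v} p∉uv refl = p∉uv (∈-lineˡ u v)

  ∉-line⇒≢ʳ : ∀ {u v p} → p ∉ line G u v → p ≢ v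
  ∉-line⇒≢ʳ {u} {v} p∉uv refl = p∉uv (∈-lineʳ u v)

  non-universal⇒avoiding-line : ∀ {x y} → x ≢ y → line G x y ≢ ⊤ →
                                ∃ λ z → z ≢ x × y ∉ line G x z
  non-universal⇒avoiding-line {x} {y} x≢y xy≢⊤ with p≢⊤⇒∃∉ xy≢⊤
  ... | z , z∉xy = z , ∉-line⇒≢ˡ z∉xy , y∉xz
    where
    y∉xz : y ∉ line G x z
    y∉xz y∈xz = z∉xy (∈-line-exchange y∈xz (x≢y ∘ sym) (∉-line⇒≢ʳ z∉xy ∘ sym))

  β⊆f⊆α⇒⊆-injective : (∀ u v → u ≢ v → line G u v ≢ ⊤) →
                      (f : Fin n → LineSet n) →
                      (∀ x → β G x ⊆ˡ f x × f x ⊆ˡ α G x) →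
                      ∀ x y → f x ⊆ˡ f y → x ≡ y
  β⊆f⊆α⇒⊆-injective no-universal f β⊆f⊆α x y fx⊆fy with x ≟ y
  ... | yes x≡y = x≡y
  ... | no x≢y  with non-universal⇒avoiding-line x≢y (no-universal x y x≢y)
  ...   | z , z≢x , y∉xz = contradiction (proj₂ xz∈α[y]) y∉xz
    where
    xz∈α[y] : α G y (line G x z)
    xz∈α[y] = proj₂ (β⊆f⊆α y) _ (fx⊆fy _ (proj₁ (β⊆f⊆α x) _ (z , z≢x , refl)))

lemma1 : (n : ℕ) (G : Hypergraph3 n)
         → (∀ u v → u ≢ v → line G u v ≢ ⊤)
         → (f : Fin n → LineSet n)
         → (∀ x → β G x ⊆ˡ f x × f x ⊆ˡ α G x)
         → (∀ x y → f x ≐ˡ f y → x ≡ y)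
           × (∀ x y → f x ⊆ˡ f y → f x ≐ˡ f y)
lemma1 n G no-universal f β⊆f⊆α = injective , antichain
  where
  ⊆⇒≡ : ∀ x y → f x ⊆ˡ f y → x ≡ y
  ⊆⇒≡ = β⊆f⊆α⇒⊆-injective G no-universal f β⊆f⊆α

  injective : ∀ x y → f x ≐ˡ f y → x ≡ y
  injective x y (fx⊆fy , _) = ⊆⇒≡ x y fx⊆fy

  antichain : ∀ x y → f x ⊆ˡ f y → f x ≐ˡ f y
  antichain x y fx⊆fy with ⊆⇒≡ x y fx⊆fy
  ... | refl = (λ _ → id) , (λ _ → id)
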